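{- Let $T$ be a finite rooted tree and $u$ any node of $T$. Then $rld(u)\le 2\gamma(u)+1$.
   Context: For $x>0$, $\lg x=\max(1,\log_2 x)$. In a finite rooted tree $T$, $T_u$ is the subtree rooted at $u$ and $|T_u|$ its number of nodes. Heavy-light decomposition: for a non-leaf node $u$, $heavy(u)$ is a child $v$ of $u$ maximizing $|T_v|$ (one fixed choice); the edge $(u,heavy(u))$ is heavy and all other edges from $u$ to its children are light. A node is an apex node if it is the root or the edge to its parent is light. The light subtree of $u$ is $T_u^\ell=T_u\setminus T_{heavy(u)}$ (for a leaf, $T_u^\ell=\{u\}$). Define $\gamma(u)=\lfloor\lg|T_u|\rfloor$ if $u$ is an apex node and $\gamma(u)=\lfloor\lg|T_u^\ell|\rfloor$ otherwise, and the weight class $wc(u)=\lfloor\lg\gamma(u)\rfloor$. Let $wtop(u)$ be the ancestor of $u$ (possibly $u$ itself) of smallest depth such that every node on the path from $u$ to $wtop(u)$ has weight class $\le wc(u)$. The restricted light depth $rld(u)$ is the number of light edges on the path from $u$ to $wtop(u)$. -}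

module Defs where

open import Data.Nat using (ℕ; zero; suc; _+_; _*_; _∸_; _≤_; _⊔_; _≤ᵇ_)
open import Data.Nat.Logarithm using (⌊log₂_⌋)
open import Data.Bool using (Bool; true; false; if_then_else_; not)
open import Data.List using (List; []; _∷_; length; lookup; _++_; [_])
open import Data.Fin using (Fin)
open import Data.Fin.Properties using (_≟_)
open import Data.Product using (_×_; _,_)
open import Relation.Nullary using (does)

-- ⌊lg n⌋ where lg x = max(1, log₂ x); for n ≥ 1 this equals max(1, ⌊log₂ n⌋).
flg : ℕ → ℕ
flg n = 1 ⊔ ⌊log₂ n ⌋

-- Finite rooted (unordered; children listed in some order) trees.
data Tree : Set where
  node : List Tree → Tree

size  : Tree → ℕ
sizes : List Tree → ℕ
size (node ts) = suc (sizes ts)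
sizes [] = 0
sizes (t ∷ ts) = size t + sizes ts

-- A heavy-light choice: at every non-leaf node, a child of maximum subtree size.
data Choice : Tree → Set where
  leafC  : Choice (node [])
  innerC : ∀ {ts} (h : Fin (length ts)) →
           (∀ j → size (lookup ts j) ≤ size (lookup ts h)) →
           (∀ j → Choice (lookup ts j)) → Choice (node ts)

-- Nodes of a tree, as positions (paths from the root).
data Pos : Tree → Set where
  here  : ∀ {t} → Pos t
  there : ∀ {ts} (i : Fin (length ts)) → Pos (lookup ts i) → Pos (node ts)

lightSize : (t : Tree) → Choice t → ℕ
lightSize .(node []) leafC = 1
lightSize (node ts) (innerC h _ _) = size (node ts) ∸ size (lookup ts h)

γroot : (t : Tree) → Choice t → Bool → ℕ
γroot t c apex = if apex then flg (size t) else flg (lightSize t c)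

wcOf : ℕ → ℕ
wcOf g = flg g

-- Chain of ancestors from node u up to the root of t: entries (γ(a), apex?(a)).
-- The Bool argument says whether the root of t is an apex node in the whole tree.
-- For a non-root node a, apex?(a) = true iff the edge from a to its parent is light.
chain : (t : Tree) → Choice t → Bool → Pos t → List (ℕ × Bool)
chain t c apex here = [ (γroot t c apex , apex) ]
chain .(node []) leafC apex (there () p)
chain (node ts) (innerC h m cs) apex (there i p) =
  chain (lookup ts i) (cs i) (not (does (i ≟ h))) p ++ [ (γroot (node ts) (innerC h m cs) apex , apex) ]

γ : (t : Tree) → Choice t → Pos t → ℕ
γ t c u with chain t c true u
... | [] = 0
... | (g , _) ∷ _ = g

countLight : ℕ → List (ℕ × Bool) → ℕ
countLight w [] = 0
countLight w (_ ∷ []) = 0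
countLight w ((_ , l) ∷ xs@((g , _) ∷ _)) =
  if wcOf g ≤ᵇ w then (if l then 1 else 0) + countLight w xs else 0

-- rld(u): light edges on the path from u to wtop(u)
rld : (t : Tree) → Choice t → Pos t → ℕ
rld t c u with chain t c true u
... | [] = 0
... | xs@((g , _) ∷ _) = countLight (wcOf g) xs

-- Walking up from u, every light edge at least doubles |T_a| + 1, and the parent p
-- above a light edge from a has γ(p) ≥ ⌊lg(|T_a| + 1)⌋, since T_p^ℓ ⊇ T_a ∪ {p}.
-- Hence the parent above the k-th light edge has γ ≥ k. While the walk stays in
-- weight class ≤ wc(u), each such γ is below 2^(wc(u)+1) ≤ 2(γ(u)+1), so at most
-- 2γ(u)+1 light edges are crossed.
module Submission where

open import Defs
open import Data.Nat using (ℕ; zero; suc; _+_; _*_; _^_; _≤_; _<_; _≤ᵇ_; z≤n; s≤s; ⌊_/2⌋)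
open import Data.Nat.Properties hiding (_≟_)
open import Data.Nat.Logarithm using (⌊log₂_⌋; ⌊log₂⌋-mono-≤; ⌊log₂[2^n]⌋≡n)
open import Data.Nat.Logarithm.Core using (⌊log2⌋)
open import Data.Nat.Induction using (<-wellFounded)
open import Induction.WellFounded using (Acc; acc)
open import Data.Bool using (Bool; true; false; T; not; if_then_else_)
open import Data.List using (List; _∷_; lookup; _++_; [_])
open import Data.Fin using () renaming (zero to fzero; suc to fsuc)
open import Data.Fin.Properties using (_≟_)
open import Data.Product using (_×_; _,_)
open import Data.Unit using (⊤; tt)
open import Function using (_∘_)
open import Relation.Nullary using (does; yes; no; ¬_; contradiction)
open import Relation.Binary.PropositionalEquality using (_≡_; refl; sym; cong; subst)
open ≤-Reasoning

2*⌊n/2⌋≤n : ∀ n → 2 * ⌊ n /2⌋ ≤ n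
2*⌊n/2⌋≤n zero = z≤n
2*⌊n/2⌋≤n (suc zero) = z≤n
2*⌊n/2⌋≤n (suc (suc n)) =
  subst (_≤ suc (suc n)) (sym (*-suc 2 ⌊ n /2⌋)) (s≤s (s≤s (2*⌊n/2⌋≤n n)))

2^⌊log2⌋≤n : ∀ n (rec : Acc _<_ (suc n)) → 2 ^ ⌊log2⌋ (suc n) rec ≤ suc n
2^⌊log2⌋≤n zero _ = s≤s z≤n
2^⌊log2⌋≤n (suc n) (acc rs) = begin
  2 * 2 ^ ⌊log2⌋ (suc ⌊ n /2⌋) _ ≤⟨ *-monoʳ-≤ 2 (2^⌊log2⌋≤n ⌊ n /2⌋ _) ⟩
  2 * suc ⌊ n /2⌋                ≡⟨ *-suc 2 ⌊ n /2⌋ ⟩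
  suc (suc (2 * ⌊ n /2⌋))        ≤⟨ s≤s (s≤s (2*⌊n/2⌋≤n n)) ⟩
  suc (suc n)                    ∎

2^⌊log₂n⌋≤n : ∀ {n} → 0 < n → 2 ^ ⌊log₂ n ⌋ ≤ n
2^⌊log₂n⌋≤n {suc n} _ = 2^⌊log2⌋≤n n (<-wellFounded (suc n))

n<2^[1+⌊log₂n⌋] : ∀ n → n < 2 ^ suc ⌊log₂ n ⌋
n<2^[1+⌊log₂n⌋] n with 2 ^ suc ⌊log₂ n ⌋ ≤? n
... | no 2^≰n = ≰⇒> 2^≰n
... | yes 2^≤n = contradiction (begin-strict
  ⌊log₂ n ⌋                  <⟨ n<1+n ⌊log₂ n ⌋ ⟩
  suc ⌊log₂ n ⌋              ≡⟨ ⌊log₂[2^n]⌋≡n (suc ⌊log₂ n ⌋) ⟨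
  ⌊log₂ 2 ^ suc ⌊log₂ n ⌋ ⌋  ≤⟨ ⌊log₂⌋-mono-≤ 2^≤n ⟩
  ⌊log₂ n ⌋                  ∎) (<-irrefl refl)

flg-mono-≤ : ∀ {m n} → m ≤ n → flg m ≤ flg n
flg-mono-≤ m≤n = ⊔-monoʳ-≤ 1 (⌊log₂⌋-mono-≤ m≤n)

flg>0 : ∀ n → 0 < flg n
flg>0 n = m≤m⊔n 1 ⌊log₂ n ⌋

2^n≤m⇒n≤flg[m] : ∀ {n m} → 2 ^ n ≤ m → n ≤ flg m
2^n≤m⇒n≤flg[m] {n} {m} 2^n≤m = begin
  n                 ≡⟨ ⌊log₂[2^n]⌋≡n n ⟨
  ⌊log₂ 2 ^ n ⌋     ≤⟨ ⌊log₂⌋-mono-≤ 2^n≤m ⟩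
  ⌊log₂ m ⌋         ≤⟨ m≤n⊔m 1 ⌊log₂ m ⌋ ⟩
  flg m             ∎

wcOf[n]≤w⇒n<2^[1+w] : ∀ {n w} → wcOf n ≤ w → n < 2 ^ suc w
wcOf[n]≤w⇒n<2^[1+w] {n} wc≤w = <-≤-trans (n<2^[1+⌊log₂n⌋] n)
  (^-monoʳ-≤ 2 (s≤s (≤-trans (m≤n⊔m 1 ⌊log₂ n ⌋) wc≤w)))

2^flg[n]≤1+n : ∀ {n} → 0 < n → 2 ^ flg n ≤ suc n
2^flg[n]≤1+n {n} 0<n with ⌊log₂ n ⌋ | 2^⌊log₂n⌋≤n 0<n
... | zero  | _      = s≤s 0<n
... | suc _ | 2^≤n   = m≤n⇒m≤1+n 2^≤n

<2^[1+flg[g]]⇒≤2g+1 : ∀ {n g} → 0 < g → n < 2 ^ suc (flg g) → n ≤ 2 * g + 1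
<2^[1+flg[g]]⇒≤2g+1 {n} {g} 0<g n< = ≤-pred (begin
  suc n            ≤⟨ n< ⟩
  2 * 2 ^ flg g    ≤⟨ *-monoʳ-≤ 2 (2^flg[n]≤1+n 0<g) ⟩
  2 * suc g        ≡⟨ *-suc 2 g ⟩
  2 + 2 * g        ≡⟨ +-comm 2 (2 * g) ⟩
  2 * g + 2        ≡⟨ +-suc (2 * g) 1 ⟩
  suc (2 * g + 1)  ∎)

-- Guaranteed by the edge from a node with |T| = s to its parent with |T| = s′ and γ = g′,
-- when the edge is light.
LightStep : Bool → ℕ → ℕ → ℕ → Set
LightStep false _ _  _  = ⊤
LightStep true  s s′ g′ = 2 * suc s ≤ suc s′ × flg (suc s) ≤ g′

-- Ascent xs s sₜ lₜ: xs lists (γ, light?) upwards from a node with |T| = s to a node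
-- with |T| = sₜ and flag lₜ.
data Ascent : List (ℕ × Bool) → ℕ → ℕ → Bool → Set where
  end    : ∀ {g l s} → 0 < g → Ascent [ (g , l) ] s s l
  _∷⟨_⟩_ : ∀ {g l s g′ l′ xs s′ sₜ lₜ} → 0 < g → s ≤ s′ × LightStep l s s′ g′ →
           Ascent ((g′ , l′) ∷ xs) s′ sₜ lₜ → Ascent ((g , l) ∷ (g′ , l′) ∷ xs) s sₜ lₜ

_∷ʳ⟨_⟩_ : ∀ {xs s sₜ lₜ g′ l′ s′} → Ascent xs s sₜ lₜ → sₜ ≤ s′ × LightStep lₜ sₜ s′ g′ →
          0 < g′ → Ascent (xs ++ [ (g′ , l′) ]) s s′ l′
end 0<g            ∷ʳ⟨ step ⟩ 0<g′ = 0<g ∷⟨ step ⟩ end 0<g′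
(0<g ∷⟨ st ⟩ asc) ∷ʳ⟨ step ⟩ 0<g′ = 0<g ∷⟨ st ⟩ (asc ∷ʳ⟨ step ⟩ 0<g′)

head-γ>0 : ∀ {g l xs s sₜ lₜ} → Ascent ((g , l) ∷ xs) s sₜ lₜ → 0 < g
head-γ>0 (end 0<g)       = 0<g
head-γ>0 (0<g ∷⟨ _ ⟩ _) = 0<g

-- k counts the light edges crossed so far; the invariant is 2^(k+1) ≤ s + 1.
countLight-bound : ∀ w k {xs s sₜ lₜ} → Ascent xs s sₜ lₜ →
                   2 ^ suc k ≤ suc s → k < 2 ^ suc w → k + countLight w xs < 2 ^ suc w
countLight-bound w k (end _) _ k< = subst (_< 2 ^ suc w) (sym (+-identityʳ k)) k<
countLight-bound w k (_∷⟨_⟩_ {l = l} {s} {g′} {l′} {xs} {s′} _ (s≤s′ , step) asc) 2^k≤ k<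
  with wcOf g′ ≤ᵇ w in wc≤ᵇw
... | false = subst (_< 2 ^ suc w) (sym (+-identityʳ k)) k<
... | true  = cross l step
  where
  g′<2^[1+w] : g′ < 2 ^ suc w
  g′<2^[1+w] = wcOf[n]≤w⇒n<2^[1+w] (≤ᵇ⇒≤ (wcOf g′) w (subst T (sym wc≤ᵇw) tt))

  cross : ∀ l → LightStep l s s′ g′ →
          k + ((if l then 1 else 0) + countLight w ((g′ , l′) ∷ xs)) < 2 ^ suc w
  cross false _ = countLight-bound w k asc (≤-trans 2^k≤ (s≤s s≤s′)) k<
  cross true (doubling , flg≤g′) =
    subst (_< 2 ^ suc w) (sym (+-suc k (countLight w ((g′ , l′) ∷ xs))))
      (countLight-bound w (suc k) asc (≤-trans (*-monoʳ-≤ 2 2^k≤) doubling)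
        (<-≤-trans (s≤s (≤-trans (2^n≤m⇒n≤flg[m] 2^k≤) flg≤g′)) g′<2^[1+w]))

sizeAt : (t : Tree) → Pos t → ℕ
sizeAt t here = size t
sizeAt (node ts) (there i p) = sizeAt (lookup ts i) p

sizeAt>0 : ∀ t p → 0 < sizeAt t p
sizeAt>0 (node _) here = s≤s z≤n
sizeAt>0 (node ts) (there i p) = sizeAt>0 (lookup ts i) p

size-lookup≤sizes : ∀ ts i → size (lookup ts i) ≤ sizes ts
size-lookup≤sizes (t ∷ ts) fzero = m≤m+n (size t) (sizes ts)
size-lookup≤sizes (t ∷ ts) (fsuc i) = ≤-trans (size-lookup≤sizes ts i) (m≤n+m (sizes ts) (size t))

size-lookup+size-lookup≤sizes : ∀ ts {i j} → ¬ i ≡ j →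
                                size (lookup ts i) + size (lookup ts j) ≤ sizes ts
size-lookup+size-lookup≤sizes (t ∷ ts) {fzero} {fzero} i≢j = contradiction refl i≢j
size-lookup+size-lookup≤sizes (t ∷ ts) {fzero} {fsuc j} _ =
  +-monoʳ-≤ (size t) (size-lookup≤sizes ts j)
size-lookup+size-lookup≤sizes (t ∷ ts) {fsuc i} {fzero} _ =
  subst (_≤ size t + sizes ts) (+-comm (size t) _) (+-monoʳ-≤ (size t) (size-lookup≤sizes ts i))
size-lookup+size-lookup≤sizes (t ∷ ts) {fsuc i} {fsuc j} i≢j =
  ≤-trans (size-lookup+size-lookup≤sizes ts (i≢j ∘ cong fsuc)) (m≤n+m (sizes ts) (size t))

γroot>0 : ∀ t c apex → 0 < γroot t c apex
γroot>0 t c true  = flg>0 (size t)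
γroot>0 t c false = flg>0 (lightSize t c)

lightStep-child : ∀ ts h heavy (cs : ∀ j → Choice (lookup ts j)) apex i →
                  LightStep (not (does (i ≟ h))) (size (lookup ts i)) (size (node ts))
                            (γroot (node ts) (innerC h heavy cs) apex)
lightStep-child ts h heavy cs apex i with i ≟ h
... | yes _ = tt
lightStep-child ts h heavy cs apex i | no i≢h = doubling , flg-bound apex
  where
  s  = size (lookup ts i)
  sₕ = size (lookup ts h)

  light+heavy : suc s + sₕ ≤ size (node ts)
  light+heavy = s≤s (size-lookup+size-lookup≤sizes ts i≢h)

  doubling : 2 * suc s ≤ suc (size (node ts))
  doubling = begin
    2 * suc s                ≡⟨ *-suc 2 s ⟩
    suc (suc (s + (s + 0)))  ≡⟨ cong (λ n → suc (suc (s + n))) (+-identityʳ s) ⟩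
    suc (suc (s + s))        ≤⟨ s≤s (s≤s (+-monoʳ-≤ s (heavy i))) ⟩
    suc (suc (s + sₕ))       ≤⟨ s≤s light+heavy ⟩
    suc (size (node ts))     ∎

  flg-bound : ∀ apex → flg (suc s) ≤ γroot (node ts) (innerC h heavy cs) apex
  flg-bound true  = flg-mono-≤ (≤-trans (m≤m+n (suc s) sₕ) light+heavy)
  flg-bound false = flg-mono-≤ (m+n≤o⇒m≤o∸n (suc s) light+heavy)

chain-ascent : ∀ t c apex p → Ascent (chain t c apex p) (sizeAt t p) (size t) apex
chain-ascent t c apex here = end (γroot>0 t c apex)
chain-ascent (node ts) (innerC h heavy cs) apex (there i p) =
  chain-ascent (lookup ts i) (cs i) (not (does (i ≟ h))) p
    ∷ʳ⟨ m≤n⇒m≤1+n (size-lookup≤sizes ts i) , lightStep-child ts h heavy cs apex i ⟩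
    γroot>0 (node ts) (innerC h heavy cs) apex

lemma4 : (t : Tree) (c : Choice t) (u : Pos t) → rld t c u ≤ 2 * γ t c u + 1
lemma4 t c u with chain t c true u | chain-ascent t c true u | sizeAt>0 t u
... | (g , _) ∷ _ | asc | 0<s =
  <2^[1+flg[g]]⇒≤2g+1 (head-γ>0 asc)
    (countLight-bound (wcOf g) 0 asc (s≤s 0<s) (m^n>0 2 (suc (wcOf g))))
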